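{- Let $\Pi=(\iota,\tau,\beta)$ be a safety problem over a vocabulary $\Sigma$, let $w$ be a fresh constant symbol, and let $\varphi(x)$ be a formula over $\Sigma$. Then $\varphi(w)$ is a sound prophecy for $\Pi$ if and only if the following safety problem over the vocabulary $\Sigma\cup\{m(\cdot)\}$, where $m$ is a fresh unary relation symbol, is safe: $$\Pi^{\mathrm{sound}}_{\varphi}=\Big(\iota\wedge\forall x.\,\varphi(x)\to m(x),\ \ \tau\wedge\forall x.\,(m(x)\wedge\varphi(x)\wedge\varphi'(x))\to m'(x),\ \ \beta\wedge\forall x.\,\varphi(x)\to\neg m(x)\Big).$$
   Context: For a vocabulary $\Sigma$, $\Sigma'=\{a'\mid a\in\Sigma\}$ is a disjoint copy and $\varphi'$ denotes $\varphi$ with every symbol replaced by its primed counterpart. A safety problem over $\Sigma$ is a triple $(\iota,\tau,\beta)$ of closed formulas, $\iota,\beta$ over $\Sigma$ and $\tau$ over $\Sigma\cup\Sigma'$. A trace is a finite sequence of $\Sigma$-structures $s_0,\dots,s_k$ over a common domain with each consecutive pair $(s_i,s_{i+1})$ satisfying $\tau$ (pre-state interpreting $\Sigma$, post-state interpreting $\Sigma'$); a trace from $\iota$ to $\beta$ has $s_0\models\iota$ and $s_k\models\beta$. A safety problem is safe if it has no trace from its initial formula to its bad formula. For $\varphi(x)$ a formula over $\Sigma$ with free variable $x$, and $w$ a fresh constant symbol, define the safety problem over $\Sigma\cup\{w\}$ $$\Pi^w_\varphi=\big(\iota\wedge\varphi(w),\ \varphi(w)\wedge\tau\wedge w'=w\wedge(\varphi(w))',\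 \beta\wedge\varphi(w)\big).$$ $\varphi(w)$ is a sound prophecy for $\Pi$ if for every trace of $\Pi$ from $\iota$ to $\beta$ there exists an interpretation of $w$ (expanding the states of the trace) that results in a trace of $\Pi^w_\varphi$ from $\iota\wedge\varphi(w)$ to $\beta\wedge\varphi(w)$. -}

module Defs where

open import Data.Nat using (ℕ; zero; suc)
open import Data.Fin using (Fin; zero; suc; inject₁; fromℕ)
open import Data.Vec using (Vec; []; _∷_)
open import Data.Sum using (_⊎_; inj₁; inj₂)
open import Data.Product using (Σ; _×_; _,_)
open import Data.Empty using (⊥)
open import Data.Unit using (⊤)
open import Relation.Nullary using (¬_)
open import Relation.Binary.PropositionalEquality using (_≡_)

-- Vocabularies (one-sorted first-order logic with equality).
-- Fun k / Rel k : function / relation symbols of arity k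
-- (constants are function symbols of arity 0).

record Vocab : Set₁ where
  field
    Fun : ℕ → Set
    Rel : ℕ → Set
open Vocab public

_⊕_ : Vocab → Vocab → Vocab
V ⊕ U = record { Fun = λ k → Fun V k ⊎ Fun U k ; Rel = λ k → Rel V k ⊎ Rel U k }

data WFun : ℕ → Set where
  w : WFun 0

data NoSym : ℕ → Set where

ConstW : Vocab
ConstW = record { Fun = WFun ; Rel = NoSym }

data MRel : ℕ → Set where
  m : MRel 1

RelM : Vocab
RelM = record { Fun = NoSym ; Rel = MRel }

-- Syntax (de Bruijn variables; Formula V n has n free variables,
-- a binder introduces the new variable as `zero`).

data Term (V : Vocab) (n : ℕ) : Set where
  var : Fin n → Term V n
  app : ∀ {k} → Fun V k → Vec (Term V n) k → Term V n

infixr 6 _∧̇_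
infixr 5 _∨̇_
infixr 4 _⇒̇_
infix 7 _≐_

data Formula (V : Vocab) (n : ℕ) : Set where
  rel  : ∀ {k} → Rel V k → Vec (Term V n) k → Formula V n
  _≐_  : Term V n → Term V n → Formula V n
  ⊤̇ ⊥̇ : Formula V n
  ¬̇_   : Formula V n → Formula V n
  _∧̇_ _∨̇_ _⇒̇_ : Formula V n → Formula V n → Formula V n
  ∀̇_ ∃̇_ : Formula V (suc n) → Formula V n

record _↪_ (V U : Vocab) : Set where
  field
    funE : ∀ {k} → Fun V k → Fun U k
    relE : ∀ {k} → Rel V k → Rel U k
open _↪_ public

left : ∀ {V U} → V ↪ (V ⊕ U)
left = record { funE = inj₁ ; relE = inj₁ }

right : ∀ {V U} → U ↪ (V ⊕ U)
right = record { funE = inj₂ ; relE = inj₂ }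

both : ∀ {V U} → V ↪ U → (V ⊕ V) ↪ (U ⊕ U)
both ρ = record { funE = λ { (inj₁ f) → inj₁ (funE ρ f) ; (inj₂ f) → inj₂ (funE ρ f) }
                ; relE = λ { (inj₁ r) → inj₁ (relE ρ r) ; (inj₂ r) → inj₂ (relE ρ r) } }

mutual
  renT : ∀ {V U n} → V ↪ U → Term V n → Term U n
  renT ρ (var i) = var i
  renT ρ (app f ts) = app (funE ρ f) (renTs ρ ts)

  renTs : ∀ {V U n k} → V ↪ U → Vec (Term V n) k → Vec (Term U n) k
  renTs ρ [] = []
  renTs ρ (t ∷ ts) = renT ρ t ∷ renTs ρ ts

renF : ∀ {V U n} → V ↪ U → Formula V n → Formula U n
renF ρ (rel r ts) = rel (relE ρ r) (renTs ρ ts)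
renF ρ (t ≐ u) = renT ρ t ≐ renT ρ u
renF ρ ⊤̇ = ⊤̇
renF ρ ⊥̇ = ⊥̇
renF ρ (¬̇ φ) = ¬̇ renF ρ φ
renF ρ (φ ∧̇ ψ) = renF ρ φ ∧̇ renF ρ ψ
renF ρ (φ ∨̇ ψ) = renF ρ φ ∨̇ renF ρ ψ
renF ρ (φ ⇒̇ ψ) = renF ρ φ ⇒̇ renF ρ ψ
renF ρ (∀̇ φ) = ∀̇ renF ρ φ
renF ρ (∃̇ φ) = ∃̇ renF ρ φ

-- priming: φ over V  ↦  φ' over V ⊕ V (second copy = primed symbols);
-- the unprimed symbols of V are the first copy.
unprimed : ∀ {V n} → Formula V n → Formula (V ⊕ V) n
unprimed = renF left

primed : ∀ {V n} → Formula V n → Formula (V ⊕ V) n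
primed = renF right

liftV : ∀ {n m} → (Fin n → Fin m) → Fin (suc n) → Fin (suc m)
liftV r zero = zero
liftV r (suc i) = suc (r i)

mutual
  wkT : ∀ {V n m} → (Fin n → Fin m) → Term V n → Term V m
  wkT r (var i) = var (r i)
  wkT r (app f ts) = app f (wkTs r ts)

  wkTs : ∀ {V n m k} → (Fin n → Fin m) → Vec (Term V n) k → Vec (Term V m) k
  wkTs r [] = []
  wkTs r (t ∷ ts) = wkT r t ∷ wkTs r ts

liftS : ∀ {V n m} → (Fin n → Term V m) → Fin (suc n) → Term V (suc m)
liftS σ zero = var zero
liftS σ (suc i) = wkT suc (σ i)

mutual
  subT : ∀ {V n m} → (Fin n → Term V m) → Term V n → Term V m
  subT σ (var i) = σ i
  subT σ (app f ts) = app f (subTs σ ts)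

  subTs : ∀ {V n m k} → (Fin n → Term V m) → Vec (Term V n) k → Vec (Term V m) k
  subTs σ [] = []
  subTs σ (t ∷ ts) = subT σ t ∷ subTs σ ts

subF : ∀ {V n m} → (Fin n → Term V m) → Formula V n → Formula V m
subF σ (rel r ts) = rel r (subTs σ ts)
subF σ (t ≐ u) = subT σ t ≐ subT σ u
subF σ ⊤̇ = ⊤̇
subF σ ⊥̇ = ⊥̇
subF σ (¬̇ φ) = ¬̇ subF σ φ
subF σ (φ ∧̇ ψ) = subF σ φ ∧̇ subF σ ψ
subF σ (φ ∨̇ ψ) = subF σ φ ∨̇ subF σ ψ
subF σ (φ ⇒̇ ψ) = subF σ φ ⇒̇ subF σ ψ
subF σ (∀̇ φ) = ∀̇ subF (liftS σ) φ
subF σ (∃̇ φ) = ∃̇ subF (liftS σ) φ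

_[_] : ∀ {V} → Formula V 1 → Term V 0 → Formula V 0
φ [ t ] = subF (λ _ → t) φ

record Struct (V : Vocab) (D : Set) : Set₁ where
  field
    funI : ∀ {k} → Fun V k → Vec D k → D
    relI : ∀ {k} → Rel V k → Vec D k → Set
open Struct public

_∷ᵉ_ : ∀ {D : Set} {n} → D → (Fin n → D) → Fin (suc n) → D
(d ∷ᵉ ρ) zero = d
(d ∷ᵉ ρ) (suc i) = ρ i

mutual
  evalT : ∀ {V D n} → Struct V D → (Fin n → D) → Term V n → D
  evalT s ρ (var i) = ρ i
  evalT s ρ (app f ts) = funI s f (evalTs s ρ ts)

  evalTs : ∀ {V D n k} → Struct V D → (Fin n → D) → Vec (Term V n) k → Vec D k
  evalTs s ρ [] = []
  evalTs s ρ (t ∷ ts) = evalT s ρ t ∷ evalTs s ρ ts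

Sat : ∀ {V D n} → Struct V D → (Fin n → D) → Formula V n → Set
Sat s ρ (rel r ts) = relI s r (evalTs s ρ ts)
Sat s ρ (t ≐ u) = evalT s ρ t ≡ evalT s ρ u
Sat s ρ ⊤̇ = ⊤
Sat s ρ ⊥̇ = ⊥
Sat s ρ (¬̇ φ) = ¬ Sat s ρ φ
Sat s ρ (φ ∧̇ ψ) = Sat s ρ φ × Sat s ρ ψ
Sat s ρ (φ ∨̇ ψ) = Sat s ρ φ ⊎ Sat s ρ ψ
Sat s ρ (φ ⇒̇ ψ) = Sat s ρ φ → Sat s ρ ψ
Sat {D = D} s ρ (∀̇ φ) = (d : D) → Sat s (d ∷ᵉ ρ) φ
Sat {D = D} s ρ (∃̇ φ) = Σ D λ d → Sat s (d ∷ᵉ ρ) φ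

noVars : ∀ {D : Set} → Fin 0 → D
noVars ()

infix 3 _⊨_
_⊨_ : ∀ {V D} → Struct V D → Formula V 0 → Set
s ⊨ φ = Sat s noVars φ

_⊕ˢ_ : ∀ {V U D} → Struct V D → Struct U D → Struct (V ⊕ U) D
s ⊕ˢ t = record { funI = λ { (inj₁ f) → funI s f ; (inj₂ f) → funI t f }
                ; relI = λ { (inj₁ r) → relI s r ; (inj₂ r) → relI t r } }

wStruct : ∀ {D : Set} → D → Struct ConstW D
wStruct d = record { funI = λ { w [] → d } ; relI = λ () }

expandW : ∀ {V D} → Struct V D → D → Struct (V ⊕ ConstW) D
expandW s d = s ⊕ˢ wStruct d

record SafetyProblem (V : Vocab) : Set where
  field
    ι : Formula V 0
    τ : Formula (V ⊕ V) 0
    β : Formula V 0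
open SafetyProblem public

IsTrace : ∀ {V D} → Formula (V ⊕ V) 0 → (k : ℕ) → (Fin (suc k) → Struct V D) → Set
IsTrace τ' k st = (i : Fin k) → (st (inject₁ i) ⊕ˢ st (suc i)) ⊨ τ'

IsTraceFromTo : ∀ {V D} → SafetyProblem V → (k : ℕ) → (Fin (suc k) → Struct V D) → Set
IsTraceFromTo Π k st = IsTrace (τ Π) k st × (st zero ⊨ ι Π) × (st (fromℕ k) ⊨ β Π)

Safe : ∀ {V} → SafetyProblem V → Set₁
Safe {V} Π = (D : Set) (k : ℕ) (st : Fin (suc k) → Struct V D) → ¬ IsTraceFromTo Π k st

wT : ∀ {V n} → Term (V ⊕ ConstW) n
wT = app (inj₂ w) []

φ⟨w⟩ : ∀ {V} → Formula V 1 → Formula (V ⊕ ConstW) 0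
φ⟨w⟩ φ = renF left φ [ wT ]

ΠW : ∀ {V} → SafetyProblem V → Formula V 1 → SafetyProblem (V ⊕ ConstW)
ΠW Π φ = record
  { ι = renF left (ι Π) ∧̇ φ⟨w⟩ φ
  ; τ = unprimed (φ⟨w⟩ φ) ∧̇ renF (both left) (τ Π)
          ∧̇ (renT right wT ≐ renT left wT) ∧̇ primed (φ⟨w⟩ φ)
  ; β = renF left (β Π) ∧̇ φ⟨w⟩ φ
  }

SoundProphecy : ∀ {V} → SafetyProblem V → Formula V 1 → Set₁
SoundProphecy {V} Π φ =
  (D : Set) (k : ℕ) (st : Fin (suc k) → Struct V D) → IsTraceFromTo Π k st →
  Σ D λ d → IsTraceFromTo (ΠW Π φ) k (λ i → expandW (st i) d)

mx : ∀ {V} → Formula (V ⊕ RelM) 1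
mx = rel (inj₂ m) (var zero ∷ [])

ΠSound : ∀ {V} → SafetyProblem V → Formula V 1 → SafetyProblem (V ⊕ RelM)
ΠSound Π φ = record
  { ι = renF left (ι Π) ∧̇ ∀̇ (renF left φ ⇒̇ mx)
  ; τ = renF (both left) (τ Π)
          ∧̇ ∀̇ ((unprimed mx ∧̇ unprimed (renF left φ) ∧̇ primed (renF left φ))
                 ⇒̇ primed mx)
  ; β = renF left (β Π) ∧̇ ∀̇ (renF left φ ⇒̇ ¬̇ mx)
  }

{-# OPTIONS --safe #-}
-- A prophecy witness w must satisfy φ in every state of the trace. In Π^sound the relation m
-- is propagated along every step on which φ keeps holding, so an x satisfying φ throughout a
-- Π^sound-trace stays in m and is excluded by the bad condition ∀x. φ(x) → ¬m(x); a sound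
-- prophecy provides such an x. Conversely, reading m at step i as "φ has held at every state
-- up to i" turns a Π-trace into a Π^sound-trace, which reaches the bad states exactly when no
-- x satisfies φ throughout the trace.
module Submission where

open import Defs
open import Level using (0ℓ)
open import Axiom.ExcludedMiddle using (ExcludedMiddle)
open import Function.Bundles using (_⇔_; mk⇔; Equivalence)
open import Function.Construct.Identity using (⇔-id)
open import Function.Properties.Equivalence using () renaming (trans to ⇔-trans)
open import Function.Related.TypeIsomorphisms using (→-cong-⇔; ¬-cong-⇔)
open import Data.Product.Function.NonDependent.Propositional using (_×-⇔_)
open import Data.Sum.Function.Propositional using (_⊎-⇔_)
open import Data.Nat using (ℕ; suc)
open import Data.Fin using (Fin; zero; suc; inject₁; fromℕ; _≤_; _≟_)
open import Data.Fin.Properties using (≤fromℕ; ≤∧≢⇒<; <⇒≤pred)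
open import Data.Fin.Induction using (<-weakInduction)
open import Data.Vec using (Vec; []; _∷_)
open import Data.Sum using (inj₁; inj₂)
open import Data.Product as Product using (∃; _×_; _,_; proj₁; proj₂)
open import Relation.Nullary using (¬_; yes; no)
open import Relation.Nullary.Decidable using (decidable-stable)
open import Relation.Binary.PropositionalEquality using (_≡_; refl; cong; cong₂)
open import Function using (_∘_)

open Equivalence using (to; from)

∀-cong-⇔ : ∀ {A : Set} {P Q : A → Set} → (∀ x → P x ⇔ Q x) → (∀ x → P x) ⇔ (∀ x → Q x)
∀-cong-⇔ P⇔Q = mk⇔ (λ p x → to (P⇔Q x) (p x)) (λ q x → from (P⇔Q x) (q x))

∃-cong-⇔ : ∀ {A : Set} {P Q : A → Set} → (∀ x → P x ⇔ Q x) → ∃ P ⇔ ∃ Q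
∃-cong-⇔ P⇔Q = mk⇔ (Product.map₂ (to (P⇔Q _))) (Product.map₂ (from (P⇔Q _)))

module _ {V U : Vocab} {D : Set} (ρ : V ↪ U) {s : Struct V D} {s′ : Struct U D}
         (funI-ρ : ∀ {k} (f : Fun V k) xs → funI s′ (funE ρ f) xs ≡ funI s f xs)
         (relI-ρ : ∀ {k} (r : Rel V k) xs → relI s′ (relE ρ r) xs ≡ relI s r xs) where

  mutual
    evalT-renT : ∀ {n} (env : Fin n → D) t → evalT s′ env (renT ρ t) ≡ evalT s env t
    evalT-renT env (var i)    = refl
    evalT-renT env (app f ts) rewrite evalTs-renTs env ts = funI-ρ f _

    evalTs-renTs : ∀ {n k} (env : Fin n → D) (ts : Vec (Term V n) k) →
                   evalTs s′ env (renTs ρ ts) ≡ evalTs s env ts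
    evalTs-renTs env []       = refl
    evalTs-renTs env (t ∷ ts) = cong₂ _∷_ (evalT-renT env t) (evalTs-renTs env ts)

  Sat-renF : ∀ {n} (env : Fin n → D) φ → Sat s′ env (renF ρ φ) ⇔ Sat s env φ
  Sat-renF env (rel r ts) rewrite evalTs-renTs env ts | relI-ρ r (evalTs s env ts) = ⇔-id _
  Sat-renF env (t ≐ u) rewrite evalT-renT env t | evalT-renT env u = ⇔-id _
  Sat-renF env ⊤̇       = ⇔-id _
  Sat-renF env ⊥̇       = ⇔-id _
  Sat-renF env (¬̇ φ)   = ¬-cong-⇔ (Sat-renF env φ)
  Sat-renF env (φ ∧̇ ψ) = Sat-renF env φ ×-⇔ Sat-renF env ψ
  Sat-renF env (φ ∨̇ ψ) = Sat-renF env φ ⊎-⇔ Sat-renF env ψ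
  Sat-renF env (φ ⇒̇ ψ) = →-cong-⇔ (Sat-renF env φ) (Sat-renF env ψ)
  Sat-renF env (∀̇ φ)   = ∀-cong-⇔ λ d → Sat-renF (d ∷ᵉ env) φ
  Sat-renF env (∃̇ φ)   = ∃-cong-⇔ λ d → Sat-renF (d ∷ᵉ env) φ

module _ {V : Vocab} {D : Set} (s : Struct V D) where

  mutual
    evalT-wkT : ∀ {n m} (r : Fin n → Fin m) (env : Fin m → D) t →
                evalT s env (wkT r t) ≡ evalT s (env ∘ r) t
    evalT-wkT r env (var i)    = refl
    evalT-wkT r env (app f ts) = cong (funI s f) (evalTs-wkTs r env ts)

    evalTs-wkTs : ∀ {n m k} (r : Fin n → Fin m) (env : Fin m → D) (ts : Vec (Term V n) k) →
                  evalTs s env (wkTs r ts) ≡ evalTs s (env ∘ r) ts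
    evalTs-wkTs r env []       = refl
    evalTs-wkTs r env (t ∷ ts) = cong₂ _∷_ (evalT-wkT r env t) (evalTs-wkTs r env ts)

  _⊢_↦_ : ∀ {n m} → (Fin m → D) → (Fin n → Term V m) → (Fin n → D) → Set
  env ⊢ σ ↦ env′ = ∀ i → evalT s env (σ i) ≡ env′ i

  liftS-↦ : ∀ {n m} {env : Fin m → D} {σ : Fin n → Term V m} {env′ : Fin n → D} →
            env ⊢ σ ↦ env′ → ∀ d → (d ∷ᵉ env) ⊢ liftS σ ↦ (d ∷ᵉ env′)
  liftS-↦ σ↦ d zero    = refl
  liftS-↦ {env = env} {σ} σ↦ d (suc i) rewrite evalT-wkT suc (d ∷ᵉ env) (σ i) = σ↦ i

  mutual
    evalT-subT : ∀ {n m} {env : Fin m → D} (σ : Fin n → Term V m) {env′} → env ⊢ σ ↦ env′ →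
                 ∀ t → evalT s env (subT σ t) ≡ evalT s env′ t
    evalT-subT σ σ↦ (var i)    = σ↦ i
    evalT-subT σ σ↦ (app f ts) = cong (funI s f) (evalTs-subTs σ σ↦ ts)

    evalTs-subTs : ∀ {n m k} {env : Fin m → D} (σ : Fin n → Term V m) {env′} → env ⊢ σ ↦ env′ →
                   (ts : Vec (Term V n) k) → evalTs s env (subTs σ ts) ≡ evalTs s env′ ts
    evalTs-subTs σ σ↦ []       = refl
    evalTs-subTs σ σ↦ (t ∷ ts) = cong₂ _∷_ (evalT-subT σ σ↦ t) (evalTs-subTs σ σ↦ ts)

  Sat-subF : ∀ {n m} {env : Fin m → D} (σ : Fin n → Term V m) {env′} → env ⊢ σ ↦ env′ →
             ∀ φ → Sat s env (subF σ φ) ⇔ Sat s env′ φ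
  Sat-subF σ σ↦ (rel r ts) rewrite evalTs-subTs σ σ↦ ts = ⇔-id _
  Sat-subF σ σ↦ (t ≐ u) rewrite evalT-subT σ σ↦ t | evalT-subT σ σ↦ u = ⇔-id _
  Sat-subF σ σ↦ ⊤̇       = ⇔-id _
  Sat-subF σ σ↦ ⊥̇       = ⇔-id _
  Sat-subF σ σ↦ (¬̇ φ)   = ¬-cong-⇔ (Sat-subF σ σ↦ φ)
  Sat-subF σ σ↦ (φ ∧̇ ψ) = Sat-subF σ σ↦ φ ×-⇔ Sat-subF σ σ↦ ψ
  Sat-subF σ σ↦ (φ ∨̇ ψ) = Sat-subF σ σ↦ φ ⊎-⇔ Sat-subF σ σ↦ ψ
  Sat-subF σ σ↦ (φ ⇒̇ ψ) = →-cong-⇔ (Sat-subF σ σ↦ φ) (Sat-subF σ σ↦ ψ)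
  Sat-subF σ σ↦ (∀̇ φ)   = ∀-cong-⇔ λ d → Sat-subF (liftS σ) (liftS-↦ σ↦ d) φ
  Sat-subF σ σ↦ (∃̇ φ)   = ∃-cong-⇔ λ d → Sat-subF (liftS σ) (liftS-↦ σ↦ d) φ

module _ {V U : Vocab} {D : Set} where

  reductˡ : Struct (V ⊕ U) D → Struct V D
  reductˡ A = record { funI = λ f → funI A (inj₁ f) ; relI = λ r → relI A (inj₁ r) }

  reductʳ : Struct (V ⊕ U) D → Struct U D
  reductʳ A = record { funI = λ f → funI A (inj₂ f) ; relI = λ r → relI A (inj₂ r) }

  Sat-left : ∀ {n} (A : Struct (V ⊕ U) D) (env : Fin n → D) ψ →
             Sat A env (renF left ψ) ⇔ Sat (reductˡ A) env ψ
  Sat-left A = Sat-renF left (λ _ _ → refl) (λ _ _ → refl)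

  Sat-right : ∀ {n} (A : Struct (V ⊕ U) D) (env : Fin n → D) ψ →
              Sat A env (renF right ψ) ⇔ Sat (reductʳ A) env ψ
  Sat-right A = Sat-renF right (λ _ _ → refl) (λ _ _ → refl)

  Sat-both-left : ∀ {n} (A B : Struct (V ⊕ U) D) (env : Fin n → D) ψ →
                  Sat (A ⊕ˢ B) env (renF (both left) ψ) ⇔ Sat (reductˡ A ⊕ˢ reductˡ B) env ψ
  Sat-both-left A B = Sat-renF (both left)
    (λ { (inj₁ f) _ → refl ; (inj₂ f) _ → refl })
    (λ { (inj₁ r) _ → refl ; (inj₂ r) _ → refl })

infix 4 _⊨_at_
_⊨_at_ : ∀ {V D} → Struct V D → Formula V 1 → D → Set
s ⊨ φ at d = Sat s (d ∷ᵉ noVars) φ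

Sat-φ⟨w⟩ : ∀ {V D} (φ : Formula V 1) (s : Struct V D) (d : D) →
           (expandW s d ⊨ φ⟨w⟩ φ) ⇔ s ⊨ φ at d
Sat-φ⟨w⟩ φ s d = ⇔-trans (Sat-subF (expandW s d) (λ _ → wT) (λ { zero → refl }) (renF left φ))
                         (Sat-left (expandW s d) (d ∷ᵉ noVars) φ)

module _ {n : ℕ} (P : Fin (suc n) → Set) where

  AllUpTo : Fin (suc n) → Set
  AllUpTo i = ∀ j → j ≤ i → P j

  AllUpTo-zero : P zero → AllUpTo zero
  AllUpTo-zero P₀ zero    _ = P₀
  AllUpTo-zero P₀ (suc j) ()

  AllUpTo-suc : ∀ {i} → AllUpTo (inject₁ i) → P (suc i) → AllUpTo (suc i)
  AllUpTo-suc {i} all Pᵢ₊₁ j j≤1+i with j ≟ suc i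
  ... | yes refl = Pᵢ₊₁
  ... | no  j≢1+i = all j (<⇒≤pred (≤∧≢⇒< j≤1+i j≢1+i))

  AllUpTo-fromℕ : AllUpTo (fromℕ n) → ∀ j → P j
  AllUpTo-fromℕ all j = all j (≤fromℕ j)

module _ {V : Vocab} (Π : SafetyProblem V) (φ : Formula V 1) {D : Set} {k : ℕ} where

  ΠW-trace⇔ : (st : Fin (suc k) → Struct V D) (d : D) →
                    IsTraceFromTo (ΠW Π φ) k (λ i → expandW (st i) d)
                      ⇔ (IsTraceFromTo Π k st × (∀ i → st i ⊨ φ at d))
  ΠW-trace⇔ st d = mk⇔ split join
    where
    φ-at : ∀ i → (expandW (st i) d ⊨ φ⟨w⟩ φ) ⇔ st i ⊨ φ at d
    φ-at i = Sat-φ⟨w⟩ φ (st i) d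

    split : IsTraceFromTo (ΠW Π φ) k (λ i → expandW (st i) d) →
            IsTraceFromTo Π k st × (∀ i → st i ⊨ φ at d)
    split (steps , (ι₀ , φ₀) , (βₖ , _)) = (τ-steps , ι-start , β-end) , φ-always
      where
      τ-steps : IsTrace (τ Π) k st
      τ-steps i = to (Sat-both-left _ _ noVars (τ Π)) (proj₁ (proj₂ (steps i)))
      ι-start : st zero ⊨ ι Π
      ι-start = to (Sat-left _ noVars (ι Π)) ι₀
      β-end : st (fromℕ k) ⊨ β Π
      β-end = to (Sat-left _ noVars (β Π)) βₖ
      φ-always : ∀ i → st i ⊨ φ at d
      φ-always zero    = to (φ-at zero) φ₀
      φ-always (suc i) =
        to (φ-at (suc i)) (to (Sat-right _ noVars (φ⟨w⟩ φ)) (proj₂ (proj₂ (proj₂ (steps i)))))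

    join : IsTraceFromTo Π k st × (∀ i → st i ⊨ φ at d) →
           IsTraceFromTo (ΠW Π φ) k (λ i → expandW (st i) d)
    join ((steps , ι₀ , βₖ) , φ-always) = w-steps , ι-start , β-end
      where
      w-holds : ∀ i → expandW (st i) d ⊨ φ⟨w⟩ φ
      w-holds i = from (φ-at i) (φ-always i)
      w-steps : IsTrace (τ (ΠW Π φ)) k (λ i → expandW (st i) d)
      w-steps i = from (Sat-left _ noVars (φ⟨w⟩ φ)) (w-holds (inject₁ i))
                , from (Sat-both-left _ _ noVars (τ Π)) (steps i)
                , refl
                , from (Sat-right _ noVars (φ⟨w⟩ φ)) (w-holds (suc i))
      ι-start : expandW (st zero) d ⊨ ι (ΠW Π φ)
      ι-start = from (Sat-left _ noVars (ι Π)) ι₀ , w-holds zero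
      β-end : expandW (st (fromℕ k)) d ⊨ β (ΠW Π φ)
      β-end = from (Sat-left _ noVars (β Π)) βₖ , w-holds (fromℕ k)

  m-holds : Struct (V ⊕ RelM) D → D → Set
  m-holds A x = relI A (inj₂ m) (x ∷ [])

  φ-now : (A B : Struct (V ⊕ RelM) D) (x : D) →
          Sat (A ⊕ˢ B) (x ∷ᵉ noVars) (unprimed (renF left φ)) ⇔ reductˡ A ⊨ φ at x
  φ-now A B x = ⇔-trans (Sat-left (A ⊕ˢ B) _ (renF left φ)) (Sat-left A _ φ)

  φ-next : (A B : Struct (V ⊕ RelM) D) (x : D) →
           Sat (A ⊕ˢ B) (x ∷ᵉ noVars) (primed (renF left φ)) ⇔ reductˡ B ⊨ φ at x
  φ-next A B x = ⇔-trans (Sat-right (A ⊕ˢ B) _ (renF left φ)) (Sat-left B _ φ)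

  ΠSound-trace⇒Π-trace : (st : Fin (suc k) → Struct (V ⊕ RelM) D) →
                      IsTraceFromTo (ΠSound Π φ) k st → IsTraceFromTo Π k (reductˡ ∘ st)
  ΠSound-trace⇒Π-trace st (steps , (ι₀ , _) , (βₖ , _)) =
    (λ i → to (Sat-both-left _ _ noVars (τ Π)) (proj₁ (steps i))) ,
    to (Sat-left _ noVars (ι Π)) ι₀ ,
    to (Sat-left _ noVars (β Π)) βₖ

  m-invariant : (st : Fin (suc k) → Struct (V ⊕ RelM) D) →
                IsTrace (τ (ΠSound Π φ)) k st → st zero ⊨ ι (ΠSound Π φ) →
                ∀ {x} → (∀ i → reductˡ (st i) ⊨ φ at x) → ∀ i → m-holds (st i) x
  m-invariant st steps (_ , m-init) {x} φ-always =
    <-weakInduction (λ i → m-holds (st i) x)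
      (m-init x (from (Sat-left _ _ φ) (φ-always zero))) m-step
    where
    m-step : ∀ i → m-holds (st (inject₁ i)) x → m-holds (st (suc i)) x
    m-step i mᵢ = proj₂ (steps i) x
      (mᵢ , from (φ-now _ _ x) (φ-always (inject₁ i)) , from (φ-next _ _ x) (φ-always (suc i)))

  history : (Fin (suc k) → Struct V D) → Fin (suc k) → Struct (V ⊕ RelM) D
  history st i = st i ⊕ˢ record
    { funI = λ ()
    ; relI = λ { m (x ∷ []) → AllUpTo (λ j → st j ⊨ φ at x) i }
    }

  history-trace : {st : Fin (suc k) → Struct V D} → IsTraceFromTo Π k st →
                  ¬ (∃ λ x → ∀ i → st i ⊨ φ at x) → IsTraceFromTo (ΠSound Π φ) k (history st)
  history-trace {st} (steps , ι₀ , βₖ) no-witness = history-steps , history-init , history-bad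
    where
    history-steps : IsTrace (τ (ΠSound Π φ)) k (history st)
    history-steps i = from (Sat-both-left _ _ noVars (τ Π)) (steps i) ,
      λ x (mᵢ , _ , φᵢ₊₁) → AllUpTo-suc _ mᵢ (to (φ-next _ _ x) φᵢ₊₁)
    history-init : history st zero ⊨ ι (ΠSound Π φ)
    history-init = from (Sat-left _ noVars (ι Π)) ι₀ ,
      λ x φ₀ → AllUpTo-zero _ (to (Sat-left _ _ φ) φ₀)
    history-bad : history st (fromℕ k) ⊨ β (ΠSound Π φ)
    history-bad = from (Sat-left _ noVars (β Π)) βₖ ,
      λ x _ mₖ → no-witness (x , AllUpTo-fromℕ _ mₖ)

sound⇒safe : ∀ {V} (Π : SafetyProblem V) (φ : Formula V 1) →
             SoundProphecy Π φ → Safe (ΠSound Π φ)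
sound⇒safe Π φ sound D k st trace@(steps , init , (_ , not-m))
  with sound D k (reductˡ ∘ st) (ΠSound-trace⇒Π-trace Π φ st trace)
... | d , prophecy-trace =
  not-m d (from (Sat-left _ _ φ) (φ-always (fromℕ k)))
          (m-invariant Π φ st steps init φ-always (fromℕ k))
  where
  φ-always : ∀ i → reductˡ (st i) ⊨ φ at d
  φ-always = proj₂ (to (ΠW-trace⇔ Π φ _ d) prophecy-trace)

safe⇒sound : ∀ {V} (Π : SafetyProblem V) (φ : Formula V 1) →
             ExcludedMiddle 0ℓ → Safe (ΠSound Π φ) → SoundProphecy Π φ
-- Safety only refutes the absence of a witness; excluded middle is what produces one.
safe⇒sound Π φ em safe D k st trace =
  Product.map₂ (λ φ-always → from (ΠW-trace⇔ Π φ st _) (trace , φ-always))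
    (decidable-stable em λ no-witness →
      safe D k (history Π φ st) (history-trace Π φ trace no-witness))

theorem5p2 : ExcludedMiddle 0ℓ → {V : Vocab} (Π : SafetyProblem V) (φ : Formula V 1) →
    SoundProphecy Π φ ⇔ Safe (ΠSound Π φ)
theorem5p2 em Π φ = mk⇔ (sound⇒safe Π φ) (safe⇒sound Π φ em)
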